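{- Let $G$ be a graph and $s$ an ordering of $V(G)$. Then $s$ is a canonical ordering of $G$ if and only if $s$ is ordered according to some canonical clique ordering of $G$.
   Context: Graphs are finite and simple. An ordering $s$ of $V(G)$ is canonical if for every triple $p,q,r$ with $p$ before $q$ before $r$ in $s$, $(p,r)\in E(G)$ implies $(q,r)\in E(G)$. An ordering $C_1,\ldots,C_t$ of all maximal cliques of $G$ is a canonical clique ordering if whenever $v\in C_i\cap C_z$ with $i\le z$, then $v\in C_j$ for all $i\le j\le z$. An ordering $s$ of $V(G)$ is ordered according to the clique ordering $C_1,\ldots,C_t$ if for all $u,v\in V(G)$ with $u$ before $v$ in $s$, there are no indices $1\le i<j\le t$ with $v\in C_i\setminus C_j$ and $u\in C_j$. -}

module Defs where

open import Data.Nat using (ℕ)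
open import Data.Bool using (Bool; true; false)
open import Data.Fin using (Fin; _<_; _≤_)
open import Data.Fin.Subset using (Subset; _∈_; _∉_; _⊆_)
open import Data.Fin.Permutation using (Permutation′; _⟨$⟩ʳ_)
open import Data.Product using (Σ; ∃; _×_; _,_)
open import Relation.Nullary using (¬_)
open import Relation.Binary.PropositionalEquality using (_≡_; _≢_)
open import Function.Definitions using (Injective)

record Graph (n : ℕ) : Set where
  field
    adj     : Fin n → Fin n → Bool
    adj-sym : ∀ u v → adj u v ≡ adj v u
    adj-irr : ∀ v → adj v v ≡ false

open Graph public

Edge : ∀ {n} → Graph n → Fin n → Fin n → Set
Edge G u v = adj G u v ≡ true

-- An ordering of V(G): a permutation; σ ⟨$⟩ʳ v is the position of vertex v.
Ordering : ℕ → Set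
Ordering n = Permutation′ n

Before : ∀ {n} → Ordering n → Fin n → Fin n → Set
Before s u v = (s ⟨$⟩ʳ u) < (s ⟨$⟩ʳ v)

IsCanonical : ∀ {n} → Graph n → Ordering n → Set
IsCanonical G s = ∀ p q r → Before s p q → Before s q r → Edge G p r → Edge G q r

IsClique : ∀ {n} → Graph n → Subset n → Set
IsClique G C = ∀ u v → u ∈ C → v ∈ C → u ≢ v → Edge G u v

IsMaximalClique : ∀ {n} → Graph n → Subset n → Set
IsMaximalClique G C = IsClique G C × (∀ D → IsClique G D → C ⊆ D → D ⊆ C)

IsCanonicalCliqueOrdering : ∀ {n} → Graph n → (t : ℕ) → (Fin t → Subset n) → Set
IsCanonicalCliqueOrdering {n} G t C =
  (∀ i → IsMaximalClique G (C i)) ×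
  Injective _≡_ _≡_ C ×
  (∀ D → IsMaximalClique G D → ∃ λ i → C i ≡ D) ×
  (∀ (v : Fin n) (i j z : Fin t) → i ≤ j → j ≤ z → v ∈ C i → v ∈ C z → v ∈ C j)

OrderedAccordingTo : ∀ {n t} → Ordering n → (Fin t → Subset n) → Set
OrderedAccordingTo {n} {t} s C =
  ∀ (u v : Fin n) → Before s u v →
    ¬ (Σ (Fin t) λ i → Σ (Fin t) λ j → i < j × v ∈ C i × v ∉ C j × u ∈ C j)

module Submission where

-- (⇐) Every clique extends greedily to a maximal clique, hence lies in some
-- C_k.  Being ordered according to C says: if u is before v, v ∈ C_i, u ∈ C_j
-- and i < j, then v ∈ C_j.  For p < q < r with pr ∈ E, take {p,r} ⊆ C_k and
-- q ∈ C_l; comparing k with l, this puts q and r in a common clique.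
-- (⇒) For canonical s let N⁺ q be q with its neighbours after q.  Canonicity
-- gives one propagation lemma (if a is not after b, b is before v and
-- v ∈ N⁺ a, then v ∈ N⁺ b), from which N⁺ q is a clique; every clique lies in
-- N⁺ of its first vertex, so the maximal cliques are the N⁺ q maximal among
-- forward neighbourhoods.  Listed by position of q, they form a canonical
-- clique ordering according to which s is ordered, again by propagation.

open import Defs
open import Data.Nat using (ℕ; zero; suc; z<s; s<s; s<s⁻¹)
import Data.Nat.Properties as ℕP
open import Data.Bool using (true)
import Data.Bool.Properties as BoolP
open import Data.Fin using (Fin; zero; suc; _<_; _≤_; _≟_; fromℕ<; inject)
import Data.Fin.Properties as FinP
open import Data.Fin.Subset using (Subset; _∈_; _∉_; _⊆_; _⊂_; _⊃_; ⁅_⁆; _∪_; Nonempty)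
import Data.Fin.Subset.Properties as SubsetP
open import Data.Fin.Subset.Induction using (⊃-wellFounded; Acc; acc)
open import Data.Fin.Permutation using (_⟨$⟩ʳ_; _⟨$⟩ˡ_; inverseˡ; inverseʳ)
open import Data.Vec using ([]; tabulate)
import Data.Vec.Properties as VecP
open import Data.Product using (Σ; ∃; _×_; _,_; proj₁; proj₂; map)
open import Data.Sum using (_⊎_; inj₁; inj₂)
open import Function using (_∘_; id)
open import Function.Bundles using (_⇔_; mk⇔; Equivalence)
open import Relation.Binary using (tri<; tri≈; tri>)
open import Relation.Nullary using (¬_; yes; no; contradiction)
open import Relation.Nullary.Decidable
  using (isYes; fromWitness; toWitness; decidable-stable; ¬?; _×-dec_; _⊎-dec_; _→-dec_)
open import Relation.Unary using (Decidable)
open import Relation.Binary.PropositionalEquality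

least : ∀ {m} {P : Fin m → Set} → Decidable P → ∃ P →
        ∃ λ i → P i × (∀ j → P j → i ≤ j)
least {m} {P} P? (x , px)
  with FinP.¬∀⟶∃¬-smallest m (¬_ ∘ P) (¬? ∘ P?) (λ none → none x px)
... | i , ¬¬pi , below = i , decidable-stable (P? i) ¬¬pi , minimal
  where
  minimal : ∀ j → P j → i ≤ j
  minimal j pj = ℕP.≮⇒≥ λ j<i →
    below (fromℕ< j<i) (subst P (sym (inject-fromℕ< j<i)) pj)
    where
    inject-fromℕ< : ∀ {j} (j<i : j < i) → inject (fromℕ< j<i) ≡ j
    inject-fromℕ< j<i = FinP.toℕ-injective
      (trans (FinP.toℕ-inject (fromℕ< j<i)) (FinP.toℕ-fromℕ< j<i))

subsetOf : ∀ {n} {P : Fin n → Set} → Decidable P → Subset n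
subsetOf P? = tabulate (isYes ∘ P?)

∈-subsetOf⁺ : ∀ {n} {P : Fin n → Set} (P? : Decidable P) {v} → P v → v ∈ subsetOf P?
∈-subsetOf⁺ P? {v} pv = VecP.lookup⇒[]= v _
  (trans (VecP.lookup∘tabulate (isYes ∘ P?) v) (Equivalence.to BoolP.T-≡ (fromWitness pv)))

∈-subsetOf⁻ : ∀ {n} {P : Fin n → Set} (P? : Decidable P) {v} → v ∈ subsetOf P? → P v
∈-subsetOf⁻ P? {v} v∈ = toWitness (Equivalence.from BoolP.T-≡
  (trans (sym (VecP.lookup∘tabulate (isYes ∘ P?) v)) (VecP.[]=⇒lookup v∈)))

record Enumeration {m : ℕ} (P : Fin m → Set) : Set where
  field
    size       : ℕ
    at         : Fin size → Fin m
    increasing : ∀ {i j} → i < j → at i < at j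
    sound      : ∀ k → P (at k)
    complete   : ∀ x → P x → ∃ λ k → at k ≡ x

  at-monotone : ∀ {i j} → i ≤ j → at i ≤ at j
  at-monotone i≤j with ℕP.m≤n⇒m<n∨m≡n i≤j
  ... | inj₁ i<j = ℕP.<⇒≤ (increasing i<j)
  ... | inj₂ i≡j = FinP.≤-reflexive (cong at (FinP.toℕ-injective i≡j))

  at-injective : ∀ {i j} → at i ≡ at j → i ≡ j
  at-injective {i} {j} eq with FinP.<-cmp i j
  ... | tri< i<j _ _ = contradiction eq (FinP.<⇒≢ (increasing i<j))
  ... | tri≈ _ i≡j _ = i≡j
  ... | tri> _ _ j<i = contradiction (sym eq) (FinP.<⇒≢ (increasing j<i))

skip-zero : ∀ {m} {P : Fin (suc m) → Set} →
            ¬ P zero → Enumeration (P ∘ suc) → Enumeration P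
skip-zero {P = P} ¬p₀ E = record
  { size = size ; at = suc ∘ at ; increasing = s<s ∘ increasing
  ; sound = sound ; complete = complete′ }
  where
  open Enumeration E
  complete′ : ∀ x → P x → ∃ λ k → suc (at k) ≡ x
  complete′ zero    p₀ = contradiction p₀ ¬p₀
  complete′ (suc x) px = map id (cong suc) (complete x px)

keep-zero : ∀ {m} {P : Fin (suc m) → Set} →
            P zero → Enumeration (P ∘ suc) → Enumeration P
keep-zero {P = P} p₀ E = record
  { size = suc size ; at = at′ ; increasing = increasing′
  ; sound = sound′ ; complete = complete′ }
  where
  open Enumeration E
  at′ : Fin (suc size) → Fin _
  at′ zero    = zero
  at′ (suc k) = suc (at k)
  increasing′ : ∀ {i j} → i < j → at′ i < at′ j
  increasing′ {zero}  {suc j} _   = z<s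
  increasing′ {suc i} {suc j} i<j = s<s (increasing (s<s⁻¹ i<j))
  sound′ : ∀ k → P (at′ k)
  sound′ zero    = p₀
  sound′ (suc k) = sound k
  complete′ : ∀ x → P x → ∃ λ k → at′ k ≡ x
  complete′ zero    _  = zero , refl
  complete′ (suc x) px = map suc (cong suc) (complete x px)

enumerate : ∀ {m} {P : Fin m → Set} → Decidable P → Enumeration P
enumerate {zero} P? = record
  { size = 0 ; at = λ () ; increasing = λ { {()} } ; sound = λ () ; complete = λ () }
enumerate {suc m} P? with P? zero
... | yes p₀ = keep-zero p₀ (enumerate (P? ∘ suc))
... | no ¬p₀ = skip-zero ¬p₀ (enumerate (P? ∘ suc))

module CliqueFacts {n : ℕ} (G : Graph n) where

  edge-sym : ∀ {u v} → Edge G u v → Edge G v u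
  edge-sym {u} {v} e = trans (adj-sym G v u) e

  singleton-clique : ∀ v → IsClique G ⁅ v ⁆
  singleton-clique v x y x∈ y∈ x≢y =
    contradiction (trans (SubsetP.x∈⁅y⁆⇒x≡y v x∈) (sym (SubsetP.x∈⁅y⁆⇒x≡y v y∈))) x≢y

  Candidate : Subset n → Set
  Candidate X = ∃ λ v → v ∉ X × (∀ c → c ∈ X → Edge G c v)

  candidate? : Decidable Candidate
  candidate? X = FinP.any? λ v → ¬? (v SubsetP.∈? X) ×-dec
    FinP.all? (λ c → (c SubsetP.∈? X) →-dec (adj G c v BoolP.≟ true))

  add-vertex : ∀ {X v} → IsClique G X → (∀ c → c ∈ X → Edge G c v) →
               IsClique G (X ∪ ⁅ v ⁆)
  add-vertex {X} {v} X-clique v-adj x y x∈ y∈ x≢y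
    with SubsetP.x∈p∪q⁻ X ⁅ v ⁆ x∈ | SubsetP.x∈p∪q⁻ X ⁅ v ⁆ y∈
  ... | inj₁ x∈X | inj₁ y∈X = X-clique x y x∈X y∈X x≢y
  ... | inj₁ x∈X | inj₂ y∈v rewrite SubsetP.x∈⁅y⁆⇒x≡y v y∈v = v-adj x x∈X
  ... | inj₂ x∈v | inj₁ y∈X rewrite SubsetP.x∈⁅y⁆⇒x≡y v x∈v = edge-sym (v-adj y y∈X)
  ... | inj₂ x∈v | inj₂ y∈v = singleton-clique v x y x∈v y∈v x≢y

  edge-clique : ∀ {u v} → Edge G u v → IsClique G (⁅ u ⁆ ∪ ⁅ v ⁆)
  edge-clique {u} uv = add-vertex (singleton-clique u) λ c c∈u →
    subst (λ x → Edge G x _) (sym (SubsetP.x∈⁅y⁆⇒x≡y u c∈u)) uv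

  no-candidate⇒maximal : ∀ {X} → IsClique G X → ¬ Candidate X → IsMaximalClique G X
  no-candidate⇒maximal {X} X-clique none = X-clique , maximal
    where
    maximal : ∀ D → IsClique G D → X ⊆ D → D ⊆ X
    maximal D D-clique X⊆D {x} x∈D = decidable-stable (x SubsetP.∈? X) λ x∉X →
      none (x , x∉X , λ c c∈X →
        D-clique c x (X⊆D c∈X) x∈D (λ c≡x → x∉X (subst (_∈ X) c≡x c∈X)))

  extend : ∀ X → Acc _⊃_ X → IsClique G X →
           ∃ λ D → IsMaximalClique G D × X ⊆ D
  extend X (acc larger) X-clique with candidate? X
  ... | no none = X , no-candidate⇒maximal X-clique none , id
  ... | yes (v , v∉X , v-adj)
    with extend (X ∪ ⁅ v ⁆) (larger X⊂X∪v) (add-vertex X-clique v-adj)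
    where
    X⊂X∪v : X ⊂ X ∪ ⁅ v ⁆
    X⊂X∪v = SubsetP.p⊆p∪q ⁅ v ⁆ , v , SubsetP.q⊆p∪q X ⁅ v ⁆ (SubsetP.x∈⁅x⁆ v) , v∉X
  ...   | D , D-maximal , X∪v⊆D = D , D-maximal , X∪v⊆D ∘ SubsetP.p⊆p∪q ⁅ v ⁆

  extend-to-maximal : ∀ {X} → IsClique G X → ∃ λ D → IsMaximalClique G D × X ⊆ D
  extend-to-maximal {X} = extend X (⊃-wellFounded X)

  -- Given a vertex z, a maximal clique D is nonempty: otherwise D ⊆ ⁅ z ⁆,
  -- and maximality would put z into D.
  maximal-nonempty : Fin n → ∀ {D} → IsMaximalClique G D → Nonempty D
  maximal-nonempty z {D} (_ , maximal) = decidable-stable (SubsetP.nonempty? D) λ empty →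
    empty (z , maximal ⁅ z ⁆ (singleton-clique z)
                 (λ {x} x∈D → contradiction (x , x∈D) empty) (SubsetP.x∈⁅x⁆ z))

module Positions {n : ℕ} (s : Ordering n) where

  pos : Fin n → Fin n
  pos v = s ⟨$⟩ʳ v

  vertexAt : Fin n → Fin n
  vertexAt i = s ⟨$⟩ˡ i

  pos-injective : ∀ {u v} → pos u ≡ pos v → u ≡ v
  pos-injective eq = trans (sym (inverseˡ s)) (trans (cong vertexAt eq) (inverseˡ s))

  before⇒≢ : ∀ {u v} → Before s u v → u ≢ v
  before⇒≢ u<v refl = FinP.<-irrefl refl u<v

  ≤∧≢⇒before : ∀ {u v} → pos u ≤ pos v → u ≢ v → Before s u v
  ≤∧≢⇒before u≤v u≢v = FinP.≤∧≢⇒< u≤v (u≢v ∘ pos-injective)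

  IsFirst : Subset n → Fin n → Set
  IsFirst D q = q ∈ D × (∀ d → d ∈ D → pos q ≤ pos d)

  first : ∀ D → Nonempty D → ∃ (IsFirst D)
  first D (x , x∈D)
    with least {P = λ i → vertexAt i ∈ D} (λ i → vertexAt i SubsetP.∈? D)
               (pos x , subst (_∈ D) (sym (inverseˡ s)) x∈D)
  ... | i , vertexAt-i∈D , minimal = vertexAt i , vertexAt-i∈D , λ d d∈D →
    subst (_≤ pos d) (sym (inverseʳ s))
          (minimal (pos d) (subst (_∈ D) (sym (inverseˡ s)) d∈D))

module FromCliqueOrdering {n : ℕ} (G : Graph n) (s : Ordering n)
         {t : ℕ} (C : Fin t → Subset n) where
  open CliqueFacts G
  open Positions s

  edge-in-clique : ∀ {D u v} → IsClique G D → u ∈ D → v ∈ D → Before s u v → Edge G u v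
  edge-in-clique D-clique u∈D v∈D u<v = D-clique _ _ u∈D v∈D (before⇒≢ u<v)

  clique-listed : (∀ D → IsMaximalClique G D → ∃ λ k → C k ≡ D) →
                  ∀ {X} → IsClique G X → ∃ λ k → X ⊆ C k
  clique-listed listed X-clique with extend-to-maximal X-clique
  ... | D , D-maximal , X⊆D with listed D D-maximal
  ...   | k , refl = k , X⊆D

  later-clique-absorbs : OrderedAccordingTo s C → ∀ {u v i j} →
    Before s u v → v ∈ C i → u ∈ C j → i < j → v ∈ C j
  later-clique-absorbs ordered {u} {v} {i} {j} u<v v∈Ci u∈Cj i<j =
    decidable-stable (v SubsetP.∈? C j) λ v∉Cj →
      ordered u v u<v (i , j , i<j , v∈Ci , v∉Cj , u∈Cj)

  shared-clique : OrderedAccordingTo s C → ∀ {p q r k l} →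
    Before s p q → Before s q r → p ∈ C k → r ∈ C k → q ∈ C l →
    ∃ λ m → q ∈ C m × r ∈ C m
  shared-clique ordered {k = k} {l} p<q q<r p∈Ck r∈Ck q∈Cl with FinP.<-cmp k l
  ... | tri< k<l _ _ = l , q∈Cl , later-clique-absorbs ordered q<r r∈Ck q∈Cl k<l
  ... | tri≈ _ refl _ = k , q∈Cl , r∈Ck
  ... | tri> _ _ l<k = k , later-clique-absorbs ordered p<q q∈Cl p∈Ck l<k , r∈Ck

  ordered⇒canonical : IsCanonicalCliqueOrdering G t C → OrderedAccordingTo s C →
                      IsCanonical G s
  ordered⇒canonical (maximal , _ , listed , _) ordered p q r p<q q<r pr
    with clique-listed listed (edge-clique pr) | clique-listed listed (singleton-clique q)
  ... | k , pr⊆Ck | l , q⊆Cl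
    with shared-clique ordered p<q q<r (pr⊆Ck (SubsetP.p⊆p∪q ⁅ r ⁆ (SubsetP.x∈⁅x⁆ p)))
           (pr⊆Ck (SubsetP.q⊆p∪q ⁅ p ⁆ ⁅ r ⁆ (SubsetP.x∈⁅x⁆ r))) (q⊆Cl (SubsetP.x∈⁅x⁆ q))
  ...   | m , q∈Cm , r∈Cm = edge-in-clique (proj₁ (maximal m)) q∈Cm r∈Cm q<r

module ForwardNeighbourhoods {n : ℕ} (G : Graph n) (s : Ordering n) where
  open Positions s

  Forward : Fin n → Fin n → Set
  Forward q v = q ≡ v ⊎ (Before s q v × Edge G q v)

  forward? : ∀ q → Decidable (Forward q)
  forward? q v = (q ≟ v) ⊎-dec ((pos q FinP.<? pos v) ×-dec (adj G q v BoolP.≟ true))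

  N⁺ : Fin n → Subset n
  N⁺ q = subsetOf (forward? q)

  q∈N⁺q : ∀ q → q ∈ N⁺ q
  q∈N⁺q q = ∈-subsetOf⁺ (forward? q) (inj₁ refl)

  N⁺-first : ∀ {q v} → v ∈ N⁺ q → pos q ≤ pos v
  N⁺-first {q} v∈ with ∈-subsetOf⁻ (forward? q) v∈
  ... | inj₁ refl = FinP.≤-refl
  ... | inj₂ (q<v , _) = ℕP.<⇒≤ q<v

  forward-edge : ∀ {q v} → Before s q v → v ∈ N⁺ q → Edge G q v
  forward-edge {q} q<v v∈ with ∈-subsetOf⁻ (forward? q) v∈
  ... | inj₁ q≡v = contradiction q≡v (before⇒≢ q<v)
  ... | inj₂ (_ , qv) = qv

  N⁺-injective : ∀ {a b} → N⁺ a ≡ N⁺ b → a ≡ b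
  N⁺-injective {a} {b} eq = pos-injective (FinP.≤-antisym
    (N⁺-first (subst (b ∈_) (sym eq) (q∈N⁺q b)))
    (N⁺-first (subst (a ∈_) eq (q∈N⁺q a))))

  clique⊆N⁺ : ∀ {D q} → IsClique G D → IsFirst D q → D ⊆ N⁺ q
  clique⊆N⁺ {q = q} D-clique (q∈D , q-first) {d} d∈D with q ≟ d
  ... | yes q≡d = ∈-subsetOf⁺ (forward? q) (inj₁ q≡d)
  ... | no q≢d = ∈-subsetOf⁺ (forward? q)
    (inj₂ (≤∧≢⇒before (q-first d d∈D) q≢d , D-clique q d q∈D d∈D q≢d))

module ForwardCliqueOrdering {n : ℕ} (G : Graph n) (s : Ordering n)
         (canonical : IsCanonical G s) where
  open CliqueFacts G
  open Positions s
  open ForwardNeighbourhoods G s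

  N⁺-propagate : ∀ {a b v} → pos a ≤ pos b → Before s b v → v ∈ N⁺ a → v ∈ N⁺ b
  N⁺-propagate {a} {b} {v} a≤b b<v v∈N⁺a with a ≟ b
  ... | yes refl = v∈N⁺a
  ... | no a≢b = ∈-subsetOf⁺ (forward? b) (inj₂ (b<v , canonical a b v a<b b<v av))
    where
    a<b : Before s a b
    a<b = ≤∧≢⇒before a≤b a≢b
    av : Edge G a v
    av = forward-edge (FinP.<-trans a<b b<v) v∈N⁺a

  -- Two forward neighbours of q are adjacent: propagate the later one to
  -- the forward neighbourhood of the earlier.
  N⁺-clique : ∀ q → IsClique G (N⁺ q)
  N⁺-clique q u v u∈ v∈ u≢v with FinP.<-cmp (pos u) (pos v)
  ... | tri< u<v _ _ = forward-edge u<v (N⁺-propagate (N⁺-first u∈) u<v v∈)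
  ... | tri≈ _ u≡v _ = contradiction (pos-injective u≡v) u≢v
  ... | tri> _ _ v<u = edge-sym (forward-edge v<u (N⁺-propagate (N⁺-first v∈) v<u u∈))

  N⁺-between : ∀ {a b c v} → pos a ≤ pos b → pos b ≤ pos c →
               v ∈ N⁺ a → v ∈ N⁺ c → v ∈ N⁺ b
  N⁺-between {b = b} {v = v} a≤b b≤c v∈N⁺a v∈N⁺c with b ≟ v
  ... | yes b≡v = ∈-subsetOf⁺ (forward? b) (inj₁ b≡v)
  ... | no b≢v = N⁺-propagate a≤b (≤∧≢⇒before (FinP.≤-trans b≤c (N⁺-first v∈N⁺c)) b≢v) v∈N⁺a

  N⁺-absorbs : ∀ {a b u v} → Before s a b → Before s u v →
               v ∈ N⁺ a → u ∈ N⁺ b → v ∈ N⁺ b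
  N⁺-absorbs a<b u<v v∈N⁺a u∈N⁺b =
    N⁺-propagate (ℕP.<⇒≤ a<b) (ℕP.≤-<-trans (N⁺-first u∈N⁺b) u<v) v∈N⁺a

  -- q is dominant when N⁺ q is maximal among forward neighbourhoods;
  -- unlike maximality among all cliques, this is decidable.
  Dominant : Fin n → Set
  Dominant q = ∀ q′ → N⁺ q ⊆ N⁺ q′ → N⁺ q′ ⊆ N⁺ q

  dominant? : Decidable Dominant
  dominant? q = FinP.all? λ q′ →
    (N⁺ q SubsetP.⊆? N⁺ q′) →-dec (N⁺ q′ SubsetP.⊆? N⁺ q)

  dominant⇒maximal : ∀ {q} → Dominant q → IsMaximalClique G (N⁺ q)
  dominant⇒maximal {q} dominant = N⁺-clique q , λ D D-clique N⁺q⊆D →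
    let d , d-first = first D (q , N⁺q⊆D (q∈N⁺q q))
        D⊆N⁺d = clique⊆N⁺ D-clique d-first
    in SubsetP.⊆-trans D⊆N⁺d (dominant d (SubsetP.⊆-trans N⁺q⊆D D⊆N⁺d))

  maximal⇒dominant : ∀ {D} → IsMaximalClique G D → Nonempty D →
                     ∃ λ q → Dominant q × N⁺ q ≡ D
  maximal⇒dominant {D} (D-clique , maximal) nonempty =
    d , dominant , SubsetP.⊆-antisym (maximal (N⁺ d) (N⁺-clique d) D⊆N⁺d) D⊆N⁺d
    where
    d = proj₁ (first D nonempty)
    D⊆N⁺d = clique⊆N⁺ D-clique (proj₂ (first D nonempty))
    dominant : Dominant d
    dominant q′ N⁺d⊆N⁺q′ = SubsetP.⊆-trans
      (maximal (N⁺ q′) (N⁺-clique q′) (SubsetP.⊆-trans D⊆N⁺d N⁺d⊆N⁺q′)) D⊆N⁺d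

  leaders : Enumeration (Dominant ∘ vertexAt)
  leaders = enumerate (dominant? ∘ vertexAt)

  open Enumeration leaders

  leader : Fin size → Fin n
  leader k = vertexAt (at k)

  pos-leader : ∀ k → pos (leader k) ≡ at k
  pos-leader k = inverseʳ s

  cliques : Fin size → Subset n
  cliques k = N⁺ (leader k)

  cliques-injective : ∀ {i j} → cliques i ≡ cliques j → i ≡ j
  cliques-injective {i} {j} eq = at-injective (begin
    at i              ≡⟨ sym (pos-leader i) ⟩
    pos (leader i)    ≡⟨ cong pos (N⁺-injective eq) ⟩
    pos (leader j)    ≡⟨ pos-leader j ⟩
    at j              ∎)
    where open ≡-Reasoning

  cliques-cover : Fin n → ∀ D → IsMaximalClique G D → ∃ λ k → cliques k ≡ D
  cliques-cover z D D-maximal with maximal⇒dominant D-maximal (maximal-nonempty z D-maximal)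
  ... | q , dominant , N⁺q≡D
    with complete (pos q) (subst Dominant (sym (inverseˡ s)) dominant)
  ...   | k , at-k≡pos-q = k , (begin
    N⁺ (vertexAt (at k))   ≡⟨ cong (N⁺ ∘ vertexAt) at-k≡pos-q ⟩
    N⁺ (vertexAt (pos q))  ≡⟨ cong N⁺ (inverseˡ s) ⟩
    N⁺ q                   ≡⟨ N⁺q≡D ⟩
    D                      ∎)
    where open ≡-Reasoning

  cliques-consecutive : ∀ (v : Fin n) (i j z : Fin size) → i ≤ j → j ≤ z →
                        v ∈ cliques i → v ∈ cliques z → v ∈ cliques j
  cliques-consecutive v i j z i≤j j≤z = N⁺-between (monotone i≤j) (monotone j≤z)
    where
    monotone : ∀ {i j} → i ≤ j → pos (leader i) ≤ pos (leader j)
    monotone {i} {j} i≤j =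
      subst₂ _≤_ (sym (pos-leader i)) (sym (pos-leader j)) (at-monotone i≤j)

  cliques-canonical : Fin n → IsCanonicalCliqueOrdering G size cliques
  cliques-canonical z = (λ k → dominant⇒maximal (sound k)) , cliques-injective ,
                        cliques-cover z , cliques-consecutive

  ordered-by-cliques : OrderedAccordingTo s cliques
  ordered-by-cliques u v u<v (i , j , i<j , v∈Ci , v∉Cj , u∈Cj) =
    v∉Cj (N⁺-absorbs leader-i<leader-j u<v v∈Ci u∈Cj)
    where
    leader-i<leader-j : Before s (leader i) (leader j)
    leader-i<leader-j = subst₂ _<_ (sym (pos-leader i)) (sym (pos-leader j)) (increasing i<j)

-- On the empty vertex set, ∅ is the only maximal clique, listed once.
empty-clique-ordering : (G : Graph 0) → IsCanonicalCliqueOrdering G 1 (λ _ → [])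
empty-clique-ordering G =
  (λ _ → (λ ()) , λ { D _ _ {()} _ }) , (λ { {zero} {zero} _ → refl }) ,
  (λ { [] _ → zero , refl }) , (λ ())

canonical⇒ordered : ∀ {n} (G : Graph n) (s : Ordering n) → IsCanonical G s →
  Σ ℕ λ t → Σ (Fin t → Subset n) λ C →
    IsCanonicalCliqueOrdering G t C × OrderedAccordingTo s C
canonical⇒ordered {zero} G s _ = 1 , (λ _ → []) , empty-clique-ordering G , λ ()
canonical⇒ordered {suc n} G s canonical =
  Enumeration.size leaders , cliques , cliques-canonical zero , ordered-by-cliques
  where open ForwardCliqueOrdering G s canonical

lemma2 : ∀ {n : ℕ} (G : Graph n) (s : Ordering n) →
    IsCanonical G s ⇔
      (Σ ℕ λ t → Σ (Fin t → Subset n) λ C →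
        IsCanonicalCliqueOrdering G t C × OrderedAccordingTo s C)
lemma2 G s = mk⇔ (canonical⇒ordered G s) λ (t , C , canonical-C , ordered) →
  FromCliqueOrdering.ordered⇒canonical G s C canonical-C ordered
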